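{- For every integer $n\geq 4$ there exists a perfect matching $M$ of the folded hypercube $FQ_n$ such that $FQ_n-M$ (obtained from $FQ_n$ by deleting the edges of $M$) is not isomorphic to the hypercube $Q_n$.
   Context: The $n$-dimensional hypercube $Q_n$ has vertex set $\{0,1\}^n$ (binary strings $x_1x_2\cdots x_n$), two vertices being adjacent iff they differ in exactly one position. The $n$-dimensional folded hypercube $FQ_n$ is obtained from $Q_n$ by adding the $2^{n-1}$ complementary edges joining each $x_1x_2\cdots x_n$ to $\overline{x}_1\overline{x}_2\cdots\overline{x}_n$, where $\overline{x}_i=1-x_i$. A perfect matching of a graph $G$ is a set of pairwise vertex-disjoint edges covering every vertex. -}

module Defs where

open import Data.Bool using (Bool; not)
open import Data.Nat using (ℕ; zero; suc)
open import Data.Vec using (Vec; []; _∷_; map)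
open import Data.Bool using (_≟_)
open import Relation.Nullary using (yes; no)
open import Data.Product using (Σ; _×_; _,_; ∃)
open import Data.Sum using (_⊎_)
open import Relation.Binary.PropositionalEquality using (_≡_; _≢_)
open import Relation.Nullary using (¬_)
open import Function.Bundles using (_↔_; Inverse)
open import Level using (0ℓ)

record Graph : Set₁ where
  field
    V   : Set
    Adj : V → V → Set

open Graph public

hamming : ∀ {n} → Vec Bool n → Vec Bool n → ℕ
hamming [] [] = 0
hamming (x ∷ xs) (y ∷ ys) with x ≟ y
... | yes _ = hamming xs ys
... | no  _ = suc (hamming xs ys)

complement : ∀ {n} → Vec Bool n → Vec Bool n
complement = map not

Q : ℕ → Graph
Q n = record { V = Vec Bool n ; Adj = λ x y → hamming x y ≡ 1 }

FQ : ℕ → Graph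
FQ n = record { V = Vec Bool n ; Adj = λ x y → (hamming x y ≡ 1) ⊎ (y ≡ complement x) }

record PerfectMatching (G : Graph) : Set₁ where
  field
    M        : V G → V G → Set
    M⊆E      : ∀ {x y} → M x y → Adj G x y
    M-sym    : ∀ {x y} → M x y → M y x
    covered  : ∀ x → ∃ λ y → M x y
    unique   : ∀ {x y z} → M x y → M x z → y ≡ z

deleteEdges : (G : Graph) → PerfectMatching G → Graph
deleteEdges G PM = record
  { V = V G
  ; Adj = λ x y → Adj G x y × ¬ PerfectMatching.M PM x y }

record _≅_ (G H : Graph) : Set where
  field
    bij      : V G ↔ V H
    preserve : ∀ x y → Adj G x y → Adj H (Inverse.to bij x) (Inverse.to bij y)
    reflect  : ∀ x y → Adj H (Inverse.to bij x) (Inverse.to bij y) → Adj G x y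

-- In Q_n (n ≥ 2) two vertices with a common neighbour always have a second
-- one, and an isomorphism transports this property. In FQ_n − M, for the
-- matching M pairing x with its flip in coordinate 1 when x₂ = 0 and in
-- coordinate 3 when x₂ = 1, the vertices 00…0 and 110…0 have the single
-- common neighbour 010…0: their other common neighbour 10…0 in Q_n is the
-- partner of 00…0, and for n ≥ 4 the complement 11…1 of 00…0 is not
-- adjacent to 110…0.
module Submission where

open import Defs
open import Data.Bool using (Bool; true; false; not)
open import Data.Bool.Properties using (not-involutive; not-¬)
open import Data.Empty using (⊥-elim)
open import Data.Fin using (Fin; zero; suc; punchIn; _≟_)
open import Data.Fin.Properties using (punchInᵢ≢i)
open import Data.Nat using (ℕ; suc; _+_; _≤_; s≤s)
open import Data.Nat.Properties using (suc-injective)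
open import Data.Product using (Σ; ∃; _×_; _,_)
open import Data.Sum using (inj₁; inj₂)
open import Data.Vec using (Vec; []; _∷_; replicate; lookup; _[_]%=_)
open import Data.Vec.Properties
  using (∷-injectiveˡ; ∷-injectiveʳ; updateAt-updateAt; updateAt-id-local; updateAt-commutes)
open import Function using (_∘_)
open import Function.Bundles using (Inverse)
open import Relation.Binary.PropositionalEquality
open import Relation.Nullary using (¬_; yes; no)

flipAt : ∀ {n} → Fin n → Vec Bool n → Vec Bool n
flipAt i x = x [ i ]%= not

flipAt-involutive : ∀ {n} (i : Fin n) (x : Vec Bool n) → flipAt i (flipAt i x) ≡ x
flipAt-involutive i x =
  trans (updateAt-updateAt i x) (updateAt-id-local i x (not-involutive (lookup x i)))

flipAt-distinct : ∀ {n} {i j : Fin n} (x : Vec Bool n) → i ≢ j → flipAt i x ≢ flipAt j x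
flipAt-distinct {i = zero}  {zero}  x       i≢j _  = i≢j refl
flipAt-distinct {i = zero}  {suc j} (b ∷ x) _   eq = not-¬ refl (sym (∷-injectiveˡ eq))
flipAt-distinct {i = suc i} {zero}  (b ∷ x) _   eq = not-¬ refl (∷-injectiveˡ eq)
flipAt-distinct {i = suc i} {suc j} (b ∷ x) i≢j eq =
  flipAt-distinct x (i≢j ∘ cong suc) (∷-injectiveʳ eq)

flipAt-≢-complement : ∀ {n} (i : Fin (2 + n)) (x : Vec Bool (2 + n)) →
                      x ≢ complement (flipAt i x)
flipAt-≢-complement zero    (a ∷ b ∷ x) eq = not-¬ refl (∷-injectiveˡ (∷-injectiveʳ eq))
flipAt-≢-complement (suc i) (a ∷ x)     eq = not-¬ refl (∷-injectiveˡ eq)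

hamming-refl : ∀ {n} (x : Vec Bool n) → hamming x x ≡ 0
hamming-refl []          = refl
hamming-refl (false ∷ x) = hamming-refl x
hamming-refl (true  ∷ x) = hamming-refl x

hamming-sym : ∀ {n} (x y : Vec Bool n) → hamming x y ≡ hamming y x
hamming-sym []          []          = refl
hamming-sym (false ∷ x) (false ∷ y) = hamming-sym x y
hamming-sym (false ∷ x) (true  ∷ y) = cong suc (hamming-sym x y)
hamming-sym (true  ∷ x) (false ∷ y) = cong suc (hamming-sym x y)
hamming-sym (true  ∷ x) (true  ∷ y) = hamming-sym x y

hamming-flipAt : ∀ {n} (i : Fin n) (x : Vec Bool n) → hamming x (flipAt i x) ≡ 1
hamming-flipAt zero    (false ∷ x) = cong suc (hamming-refl x)
hamming-flipAt zero    (true  ∷ x) = cong suc (hamming-refl x)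
hamming-flipAt (suc i) (false ∷ x) = hamming-flipAt i x
hamming-flipAt (suc i) (true  ∷ x) = hamming-flipAt i x

hamming≡0⇒≡ : ∀ {n} (x y : Vec Bool n) → hamming x y ≡ 0 → x ≡ y
hamming≡0⇒≡ []          []          _  = refl
hamming≡0⇒≡ (false ∷ x) (false ∷ y) eq = cong (false ∷_) (hamming≡0⇒≡ x y eq)
hamming≡0⇒≡ (true  ∷ x) (true  ∷ y) eq = cong (true ∷_) (hamming≡0⇒≡ x y eq)

hamming≡1⇒flipAt : ∀ {n} (x y : Vec Bool n) → hamming x y ≡ 1 → ∃ λ i → y ≡ flipAt i x
hamming≡1⇒flipAt []          []          ()
hamming≡1⇒flipAt (false ∷ x) (false ∷ y) eq with hamming≡1⇒flipAt x y eq
... | i , y≡x[i] = suc i , cong (false ∷_) y≡x[i]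
hamming≡1⇒flipAt (true  ∷ x) (true  ∷ y) eq with hamming≡1⇒flipAt x y eq
... | i , y≡x[i] = suc i , cong (true ∷_) y≡x[i]
hamming≡1⇒flipAt (false ∷ x) (true  ∷ y) eq =
  zero , cong (true ∷_) (sym (hamming≡0⇒≡ x y (suc-injective eq)))
hamming≡1⇒flipAt (true  ∷ x) (false ∷ y) eq =
  zero , cong (false ∷_) (sym (hamming≡0⇒≡ x y (suc-injective eq)))

NoUniqueCommonNeighbour : Graph → Set
NoUniqueCommonNeighbour G =
  ∀ u w v → Adj G u w → Adj G w v → ∃ λ w′ → w′ ≢ w × Adj G u w′ × Adj G w′ v

≅-reflects-NoUniqueCommonNeighbour : ∀ {G H} → G ≅ H →
                                     NoUniqueCommonNeighbour H → NoUniqueCommonNeighbour G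
≅-reflects-NoUniqueCommonNeighbour {G} {H} G≅H noUniqueH u w v uw wv =
  pullBack (noUniqueH (to u) (to w) (to v) (preserve u w uw) (preserve w v wv))
  where
  open _≅_ G≅H
  open Inverse bij
  pullBack : (∃ λ w′ → w′ ≢ to w × Adj H (to u) w′ × Adj H w′ (to v)) →
             ∃ λ z → z ≢ w × Adj G u z × Adj G z v
  pullBack (w′ , w′≢w , uw′ , w′v) =
    from w′ , w′≢w ∘ from-w′≡w⇒w′≡to-w , reflect u (from w′) uw″ , reflect (from w′) v w″v
    where
    to-from-w′ : to (from w′) ≡ w′
    to-from-w′ = strictlyInverseˡ w′
    from-w′≡w⇒w′≡to-w : from w′ ≡ w → w′ ≡ to w
    from-w′≡w⇒w′≡to-w eq = trans (sym to-from-w′) (cong to eq)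
    uw″ : Adj H (to u) (to (from w′))
    uw″ = subst (Adj H (to u)) (sym to-from-w′) uw′
    w″v : Adj H (to (from w′)) (to v)
    w″v = subst (λ t → Adj H t (to v)) (sym to-from-w′) w′v

Q-noUniqueCommonNeighbour : ∀ n → NoUniqueCommonNeighbour (Q (2 + n))
Q-noUniqueCommonNeighbour n u _ _ uw wv with hamming≡1⇒flipAt u _ uw
... | i , refl with hamming≡1⇒flipAt (flipAt i u) _ wv
... | j , refl with i ≟ j
... | yes refl =
  flipAt k u , flipAt-distinct u (punchInᵢ≢i i zero) , hamming-flipAt k u ,
  (begin
    hamming (flipAt k u) (flipAt i (flipAt i u))
      ≡⟨ cong (hamming (flipAt k u)) (flipAt-involutive i u) ⟩
    hamming (flipAt k u) u                       ≡⟨ hamming-sym (flipAt k u) u ⟩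
    hamming u (flipAt k u)                       ≡⟨ hamming-flipAt k u ⟩
    1                                            ∎)
  where
  open ≡-Reasoning
  k : Fin (2 + n)
  k = punchIn i zero
... | no i≢j =
  flipAt j u , flipAt-distinct u (i≢j ∘ sym) , hamming-flipAt j u ,
  (begin
    hamming (flipAt j u) (flipAt j (flipAt i u))
      ≡⟨ cong (hamming (flipAt j u)) (updateAt-commutes j i (i≢j ∘ sym) u) ⟩
    hamming (flipAt j u) (flipAt i (flipAt j u)) ≡⟨ hamming-flipAt i (flipAt j u) ⟩
    1                                            ∎)
  where open ≡-Reasoning

involutionMatching : (G : Graph) (f : V G → V G) →
                     (∀ x → f (f x) ≡ x) → (∀ x → Adj G x (f x)) → PerfectMatching G
involutionMatching G f f-involutive f-adjacent = record
  { M       = λ x y → y ≡ f x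
  ; M⊆E     = λ { {x} refl → f-adjacent x }
  ; M-sym   = λ { {x} refl → sym (f-involutive x) }
  ; covered = λ x → f x , refl
  ; unique  = λ y≡fx z≡fx → trans y≡fx (sym z≡fx)
  }

partner : ∀ {m} → Vec Bool (3 + m) → Vec Bool (3 + m)
partner x@(_ ∷ false ∷ _) = flipAt zero x
partner x@(_ ∷ true  ∷ _) = flipAt (suc (suc zero)) x

partner-involutive : ∀ {m} (x : Vec Bool (3 + m)) → partner (partner x) ≡ x
partner-involutive (false ∷ false ∷ _)         = refl
partner-involutive (true  ∷ false ∷ _)         = refl
partner-involutive (_     ∷ true  ∷ false ∷ _) = refl
partner-involutive (_     ∷ true  ∷ true  ∷ _) = refl

partner-adjacent : ∀ {m} (x : Vec Bool (3 + m)) → hamming x (partner x) ≡ 1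
partner-adjacent x@(_ ∷ false ∷ _) = hamming-flipAt zero x
partner-adjacent x@(_ ∷ true  ∷ _) = hamming-flipAt (suc (suc zero)) x

partnerMatching : ∀ m → PerfectMatching (FQ (3 + m))
partnerMatching m =
  involutionMatching (FQ (3 + m)) partner partner-involutive (inj₁ ∘ partner-adjacent)

module _ (m : ℕ) where

  private
    G : Graph
    G = deleteEdges (FQ (4 + m)) (partnerMatching (suc m))

    u₀ w₀ v₀ : Vec Bool (4 + m)
    u₀ = false ∷ false ∷ false ∷ false ∷ replicate m false
    w₀ = false ∷ true  ∷ false ∷ false ∷ replicate m false
    v₀ = true  ∷ true  ∷ false ∷ false ∷ replicate m false

    u₀w₀ : Adj G u₀ w₀
    u₀w₀ = inj₁ (hamming-flipAt (suc zero) u₀) , λ ()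

    w₀v₀ : Adj G w₀ v₀
    w₀v₀ = inj₁ (hamming-flipAt zero w₀) , λ ()

    w₀-uniqueCommonNeighbour : ∀ z → Adj G u₀ z → Adj G z v₀ → z ≡ w₀
    w₀-uniqueCommonNeighbour z (inj₁ u₀z , u₀z∉M) (zv₀ , _) with hamming≡1⇒flipAt u₀ z u₀z
    ... | zero , refl = ⊥-elim (u₀z∉M refl)
    ... | suc zero , refl = refl
    ... | suc (suc i) , refl with zv₀
    ...   | inj₁ ()
    ...   | inj₂ v₀≡z̄ = ⊥-elim (flipAt-≢-complement i _ (∷-injectiveʳ (∷-injectiveʳ v₀≡z̄)))
    w₀-uniqueCommonNeighbour z (inj₂ refl , _) (inj₁ () , _)
    w₀-uniqueCommonNeighbour z (inj₂ refl , _) (inj₂ () , _)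

  FQ-partner-hasUniqueCommonNeighbour :
    ¬ NoUniqueCommonNeighbour (deleteEdges (FQ (4 + m)) (partnerMatching (suc m)))
  FQ-partner-hasUniqueCommonNeighbour noUnique with noUnique u₀ w₀ v₀ u₀w₀ w₀v₀
  ... | z , z≢w₀ , u₀z , zv₀ = z≢w₀ (w₀-uniqueCommonNeighbour z u₀z zv₀)

corollary2p4 : (n : ℕ) → 4 ≤ n → Σ (PerfectMatching (FQ n)) (λ M → ¬ (deleteEdges (FQ n) M ≅ Q n))
corollary2p4 (suc (suc (suc (suc m)))) (s≤s (s≤s (s≤s (s≤s _)))) =
  partnerMatching (suc m) ,
  λ G≅Q → FQ-partner-hasUniqueCommonNeighbour m
            (≅-reflects-NoUniqueCommonNeighbour G≅Q (Q-noUniqueCommonNeighbour (2 + m)))
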